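{- Let $\lambda$ be a nonzero real number and let $(b_n(\lambda))_{n\ge0}$ be any sequence of real numbers. Define the degenerate A-algorithm matrix $(b_{n,m}(\lambda))_{n,m\ge0}$ by $b_{0,m}(\lambda)=b_m(\lambda)$ for $m\ge0$ and \[ b_{n,m}(\lambda)=(m+1)\Big(\Big(1-\frac{(n-1)\lambda}{m+1}\Big)b_{n-1,m}(\lambda)-b_{n-1,m+1}(\lambda)\Big),\qquad n\ge1,\ m\ge0. \] Let $G_\lambda(t)=\sum_{n\ge0}b_{0,n}(\lambda)t^n$ and $\overline{G}_\lambda(t)=\sum_{n\ge0}b_{n,0}(\lambda)\frac{t^n}{n!}$ (formal power series). Then, as formal power series, \[ \overline{G}_{\lambda}(t)=e_{\lambda}(t)\,G_{\lambda}\big(1-e_{\lambda}(t)\big)\qquad\text{and}\qquad (1-t)G_{\lambda}(t)=\overline{G}_{\lambda}\big(\log_{\lambda}(1-t)\big). \]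
   Context: For $n\ge0$ set $(x)_{0,\lambda}=1$ and $(x)_{n,\lambda}=x(x-\lambda)\cdots(x-(n-1)\lambda)$ for $n\ge1$. The degenerate exponential is $e_\lambda(t)=\sum_{k\ge0}(1)_{k,\lambda}\frac{t^k}{k!}$ (i.e. $(1+\lambda t)^{1/\lambda}$), a power series with constant term $1$, and $\log_\lambda$ denotes its compositional inverse, so that $\log_\lambda(1+t)=\sum_{n\ge1}\frac{(-1)^{n-1}}{n}\binom{n-1-\lambda}{n-1}t^n$. Compositions are compositions of formal power series (inner series have zero constant term). -}

module Defs where

open import Algebra.Bundles using (CommutativeRing)
open import Data.Nat using (ℕ; zero; suc; _∸_; _!)

module Series {c ℓ} (R : CommutativeRing c ℓ) where
  open CommutativeRing R

  PS : Set c
  PS = ℕ → Carrier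

  fromℕ : ℕ → Carrier
  fromℕ zero = 0#
  fromℕ (suc n) = 1# + fromℕ n

  sgn : ℕ → Carrier
  sgn zero = 1#
  sgn (suc n) = - sgn n

  sumTo : ℕ → (ℕ → Carrier) → Carrier
  sumTo zero f = f 0
  sumTo (suc n) f = sumTo n f + f (suc n)

  _≋_ : PS → PS → Set ℓ
  f ≋ g = ∀ n → f n ≈ g n

  oneS : PS
  oneS zero = 1#
  oneS (suc n) = 0#

  tS : PS
  tS zero = 0#
  tS (suc zero) = 1#
  tS (suc (suc n)) = 0#

  _-S_ : PS → PS → PS
  (f -S g) n = f n - g n

  _·_ : PS → PS → PS
  (f · g) n = sumTo n (λ i → f i * g (n ∸ i))

  powS : PS → ℕ → PS
  powS f zero = oneS
  powS f (suc k) = f · powS f k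

  -- composition g(h(t)), for h with zero constant term:
  -- [t^n] g(h(t)) = Σ_{k=0}^{n} g_k [t^n] h(t)^k
  comp : PS → PS → PS
  comp g h n = sumTo n (λ k → g k * powS h k n)

  fall : Carrier → Carrier → ℕ → Carrier
  fall x lam zero = 1#
  fall x lam (suc n) = fall x lam n * (x - fromℕ n * lam)

  -- In what follows `inv k` plays the role of 1/k for k ≥ 1.

  eλ : Carrier → (ℕ → Carrier) → PS
  eλ lam inv k = fall 1# lam k * inv (k !)

  -- log_lam(1+t) = Σ_{n≥1} (-1)^{n-1}/n * binom(n-1-lam, n-1) t^n,
  -- with binom(x, m) = x(x-1)...(x-m+1)/m!
  logλ1+ : Carrier → (ℕ → Carrier) → PS
  logλ1+ lam inv zero = 0#
  logλ1+ lam inv (suc m) =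
    sgn m * inv (suc m) * (fall (fromℕ m - lam) 1# m * inv (m !))

  logλ1- : Carrier → (ℕ → Carrier) → PS
  logλ1- lam inv n = sgn n * logλ1+ lam inv n

  -- degenerate A-algorithm matrix b_{n,m}(lam); the recursion
  -- b_{n,m} = (m+1)((1 - (n-1)lam/(m+1)) b_{n-1,m} - b_{n-1,m+1})
  -- is written (with n-1 ↦ n) with the factor (m+1) multiplied out.
  bmat : Carrier → (ℕ → Carrier) → ℕ → ℕ → Carrier
  bmat lam b zero m = b m
  bmat lam b (suc n) m =
    (fromℕ (suc m) - fromℕ n * lam) * bmat lam b n m
      - fromℕ (suc m) * bmat lam b n (suc m)

  Gλ : Carrier → (ℕ → Carrier) → PS
  Gλ lam b n = bmat lam b 0 n

  Gbarλ : Carrier → (ℕ → Carrier) → (ℕ → Carrier) → PS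
  Gbarλ lam inv b n = bmat lam b n 0 * inv (n !)

{-# OPTIONS --safe #-}
-- Write E j = (1 + λt)^((1 - jλ)/λ), so that e_λ = E 0, and u = 1 - e_λ(t).  The derivative
-- rules E j′ = (1 - jλ) E (j+1) and u′ = - E 1, the identity (1 + λt) E (j+1) = E j and the
-- chain rule give (E j · C(u))′ = E (j+1) · (A-step j C)(u), where A-step j C = (1 - jλ) C - (1 - t) C′
-- is one step of the A-algorithm.  Hence the n-th derivative of E 0 · G(u) at 0 is b_{n,0},
-- which is the first identity.  For the second, L = log_λ(1 - t) satisfies (1 - t) L′ = -(1 + λL),
-- and (1 + λt) e_λ′ = e_λ, so e_λ(L) solves (1 - t) g′ = -g with g(0) = 1.  Hence e_λ(L) = 1 - t,
-- u(L) = t, and substituting L into the first identity gives the second.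
--
-- The laws of composition (multiplicativity, associativity, chain rule) all follow from the
-- Horner recursion g(h) = g 0 + h · (shift g)(h): when h(0) = 0 its solution is unique.
module Submission where

open import Defs
open import Algebra.Bundles using (CommutativeRing)
open import Data.Nat using (ℕ; suc)
open import Data.Product using (_×_)
open import Relation.Nullary using (¬_)

open import Algebra.Solver.Ring.AlmostCommutativeRing
  using (_-Raw-AlmostCommutative⟶_; fromCommutativeRing)
open import Data.Integer as ℤ using (ℤ; +_; -[1+_])
import Data.Integer.Properties as ℤ
open import Data.Maybe using (Maybe; just; nothing)
open import Data.Nat as ℕ using (zero; _!)
open import Data.Nat.Induction using (<-rec)
import Data.Nat.Properties as ℕₚ
open import Data.Product using (_,_)
open import Data.Sign as Sign using (Sign)
import Relation.Binary.PropositionalEquality as ≡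
import Relation.Binary.Reasoning.Setoid
open import Relation.Nullary using (yes; no)

module FromℕProperties {c ℓ} (R : CommutativeRing c ℓ) where
  open CommutativeRing R
  open Series R using (fromℕ)
  open import Relation.Binary.Reasoning.Setoid setoid

  fromℕ-+ : ∀ m n → fromℕ (m ℕ.+ n) ≈ fromℕ m + fromℕ n
  fromℕ-+ zero    n = sym (+-identityˡ _)
  fromℕ-+ (suc m) n = trans (+-congˡ (fromℕ-+ m n)) (sym (+-assoc _ _ _))

  fromℕ-* : ∀ m n → fromℕ (m ℕ.* n) ≈ fromℕ m * fromℕ n
  fromℕ-* zero    n = sym (zeroˡ _)
  fromℕ-* (suc m) n = begin
    fromℕ (n ℕ.+ m ℕ.* n)              ≈⟨ fromℕ-+ n (m ℕ.* n) ⟩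
    fromℕ n + fromℕ (m ℕ.* n)          ≈⟨ +-cong (sym (*-identityˡ _)) (fromℕ-* m n) ⟩
    1# * fromℕ n + fromℕ m * fromℕ n   ≈⟨ distribʳ _ _ _ ⟨
    (1# + fromℕ m) * fromℕ n           ∎

-- The library solvers for an arbitrary commutative ring use its own elements as coefficients and
-- so cannot cancel x - x; normalising with integer coefficients, mapped into R, can.
module IntegerSolver {c ℓ} (R : CommutativeRing c ℓ) where
  open CommutativeRing R
  open import Algebra.Properties.Semiring.Mult.TCOptimised semiring
    using (1+×; ×-homo-+; ×1-homo-*) renaming (_×_ to _×ᴿ_)
  open import Algebra.Properties.Ring ring
    using (-‿involutive; -‿distribˡ-*; -‿+-comm; -0#≈0#)
  open import Algebra.Properties.CommutativeSemigroup *-commutativeSemigroup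
    using (interchange)
  open import Algebra.Properties.CommutativeSemigroup +-commutativeSemigroup
    using () renaming (interchange to +-interchange)
  open import Relation.Binary.Reasoning.Setoid setoid

  private
    ι : ℕ → Carrier
    ι n = n ×ᴿ 1#

    fromℤ : ℤ → Carrier
    fromℤ (+ n)     = ι n
    fromℤ -[1+ n ]  = - ι (suc n)

    fromSign : Sign → Carrier
    fromSign Sign.+ = 1#
    fromSign Sign.- = - 1#

    fromℤ-⊖ : ∀ m n → fromℤ (m ℤ.⊖ n) ≈ ι m - ι n
    fromℤ-⊖ m       zero    = sym (trans (+-congˡ -0#≈0#) (+-identityʳ _))
    fromℤ-⊖ zero    (suc n) = sym (+-identityˡ _)
    fromℤ-⊖ (suc m) (suc n) = begin
      fromℤ (suc m ℤ.⊖ suc n)     ≡⟨ ≡.cong fromℤ (ℤ.[1+m]⊖[1+n]≡m⊖n m n) ⟩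
      fromℤ (m ℤ.⊖ n)             ≈⟨ fromℤ-⊖ m n ⟩
      ι m - ι n                   ≈⟨ +-identityˡ _ ⟨
      0# + (ι m - ι n)            ≈⟨ +-congʳ (-‿inverseʳ 1#) ⟨
      (1# - 1#) + (ι m - ι n)     ≈⟨ +-interchange _ _ _ _ ⟩
      (1# + ι m) + (- 1# - ι n)   ≈⟨ +-congˡ (-‿+-comm 1# (ι n)) ⟩
      (1# + ι m) - (1# + ι n)     ≈⟨ +-cong (1+× m 1#) (-‿cong (1+× n 1#)) ⟨
      ι (suc m) - ι (suc n)       ∎

    fromℤ-+ : ∀ i j → fromℤ (i ℤ.+ j) ≈ fromℤ i + fromℤ j
    fromℤ-+ (+ m)    (+ n)    = ×-homo-+ 1# m n
    fromℤ-+ (+ m)    -[1+ n ] = fromℤ-⊖ m (suc n)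
    fromℤ-+ -[1+ m ] (+ n)    = trans (fromℤ-⊖ n (suc m)) (+-comm _ _)
    fromℤ-+ -[1+ m ] -[1+ n ] = begin
      - ι (suc (suc (m ℕ.+ n)))   ≡⟨ ≡.cong (λ k → - ι (suc k)) (ℕₚ.+-suc m n) ⟨
      - ι (suc m ℕ.+ suc n)       ≈⟨ -‿cong (×-homo-+ 1# (suc m) (suc n)) ⟩
      - (ι (suc m) + ι (suc n))   ≈⟨ -‿+-comm _ _ ⟨
      - ι (suc m) - ι (suc n)     ∎

    fromℤ-neg : ∀ i → fromℤ (ℤ.- i) ≈ - fromℤ i
    fromℤ-neg (+ zero)  = sym -0#≈0#
    fromℤ-neg (+ suc n) = refl
    fromℤ-neg -[1+ n ]  = sym (-‿involutive _)

    fromℤ-◃ : ∀ s n → fromℤ (s ℤ.◃ n) ≈ fromSign s * ι n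
    fromℤ-◃ s      zero    = sym (zeroʳ _)
    fromℤ-◃ Sign.+ (suc n) = sym (*-identityˡ _)
    fromℤ-◃ Sign.- (suc n) = trans (-‿cong (sym (*-identityˡ _))) (-‿distribˡ-* _ _)

    fromSign-* : ∀ s t → fromSign (s Sign.* t) ≈ fromSign s * fromSign t
    fromSign-* Sign.+ t      = sym (*-identityˡ _)
    fromSign-* Sign.- Sign.+ = sym (*-identityʳ _)
    fromSign-* Sign.- Sign.- =
      sym (trans (sym (-‿distribˡ-* _ _)) (trans (-‿cong (*-identityˡ _)) (-‿involutive _)))

    fromℤ-* : ∀ i j → fromℤ (i ℤ.* j) ≈ fromℤ i * fromℤ j
    fromℤ-* i j = begin
      fromℤ (si Sign.* sj ℤ.◃ ∣i∣ ℕ.* ∣j∣)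
        ≈⟨ fromℤ-◃ (si Sign.* sj) (∣i∣ ℕ.* ∣j∣) ⟩
      fromSign (si Sign.* sj) * ι (∣i∣ ℕ.* ∣j∣)
        ≈⟨ *-cong (fromSign-* si sj) (×1-homo-* ∣i∣ ∣j∣) ⟩
      (fromSign si * fromSign sj) * (ι ∣i∣ * ι ∣j∣)
        ≈⟨ interchange _ _ _ _ ⟩
      (fromSign si * ι ∣i∣) * (fromSign sj * ι ∣j∣)
        ≈⟨ *-cong (fromℤ-◃ si ∣i∣) (fromℤ-◃ sj ∣j∣) ⟨
      fromℤ (si ℤ.◃ ∣i∣) * fromℤ (sj ℤ.◃ ∣j∣)
        ≡⟨ ≡.cong₂ (λ x y → fromℤ x * fromℤ y) (ℤ.◃-inverse i) (ℤ.◃-inverse j) ⟩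
      fromℤ i * fromℤ j ∎
      where
      si = ℤ.sign i
      sj = ℤ.sign j
      ∣i∣ = ℤ.∣ i ∣
      ∣j∣ = ℤ.∣ j ∣

    fromℤ-≟ : ∀ i j → Maybe (fromℤ i ≈ fromℤ j)
    fromℤ-≟ i j with i ℤ.≟ j
    ... | yes ≡.refl = just refl
    ... | no _       = nothing

    fromℤ-morphism : ℤ.+-*-rawRing -Raw-AlmostCommutative⟶ fromCommutativeRing R
    fromℤ-morphism = record
      { ⟦_⟧    = fromℤ
      ; +-homo = fromℤ-+
      ; *-homo = fromℤ-*
      ; -‿homo = fromℤ-neg
      ; 0-homo = refl
      ; 1-homo = refl
      }

  open import Algebra.Solver.Ring ℤ.+-*-rawRing (fromCommutativeRing R) fromℤ-morphism
    fromℤ-≟ public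

module FiniteSums {c ℓ} (R : CommutativeRing c ℓ) where
  open CommutativeRing R
  open Series R using (sumTo)
  open import Relation.Binary.Reasoning.Setoid setoid

  sumTo-cong : ∀ n {f g : ℕ → Carrier} → (∀ i → i ℕ.≤ n → f i ≈ g i) → sumTo n f ≈ sumTo n g
  sumTo-cong zero    f≈g = f≈g 0 ℕ.z≤n
  sumTo-cong (suc n) f≈g =
    +-cong (sumTo-cong n (λ i i≤n → f≈g i (ℕₚ.m≤n⇒m≤1+n i≤n))) (f≈g (suc n) ℕₚ.≤-refl)

  sumTo-+ : ∀ n (f g : ℕ → Carrier) → sumTo n (λ i → f i + g i) ≈ sumTo n f + sumTo n g
  sumTo-+ zero    f g = refl
  sumTo-+ (suc n) f g = trans (+-congʳ (sumTo-+ n f g)) (+-interchange _ _ _ _)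
    where open import Algebra.Properties.CommutativeSemigroup +-commutativeSemigroup
            using () renaming (interchange to +-interchange)

  *-sumTo : ∀ n a (f : ℕ → Carrier) → a * sumTo n f ≈ sumTo n (λ i → a * f i)
  *-sumTo zero    a f = refl
  *-sumTo (suc n) a f = trans (distribˡ a _ _) (+-congʳ (*-sumTo n a f))

  -‿sumTo : ∀ n (f : ℕ → Carrier) → - sumTo n f ≈ sumTo n (λ i → - f i)
  -‿sumTo zero    f = refl
  -‿sumTo (suc n) f = trans (sym (-‿+-comm _ _)) (+-congʳ (-‿sumTo n f))
    where open import Algebra.Properties.Ring ring using (-‿+-comm)

  sumTo-zero : ∀ n {f : ℕ → Carrier} → (∀ i → i ℕ.≤ n → f i ≈ 0#) → sumTo n f ≈ 0#
  sumTo-zero n f≈0 = trans (sumTo-cong n f≈0) (zero-sum n)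
    where
    zero-sum : ∀ n → sumTo n (λ _ → 0#) ≈ 0#
    zero-sum zero    = refl
    zero-sum (suc n) = trans (+-identityʳ _) (zero-sum n)

  sumTo-suc : ∀ n (f : ℕ → Carrier) → sumTo (suc n) f ≈ f 0 + sumTo n (λ i → f (suc i))
  sumTo-suc zero    f = refl
  sumTo-suc (suc n) f = trans (+-congʳ (sumTo-suc n f)) (+-assoc _ _ _)

  sumTo-head : ∀ n {f : ℕ → Carrier} → (∀ i → i ℕ.≤ n → f (suc i) ≈ 0#) → sumTo n f ≈ f 0
  sumTo-head zero    f≈0 = refl
  sumTo-head (suc n) {f} f≈0 = begin
    sumTo (suc n) f                   ≈⟨ sumTo-suc n f ⟩
    f 0 + sumTo n (λ i → f (suc i))   ≈⟨ +-congˡ (sumTo-zero n (λ i i≤n → f≈0 i (ℕₚ.m≤n⇒m≤1+n i≤n))) ⟩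
    f 0 + 0#                          ≈⟨ +-identityʳ _ ⟩
    f 0                               ∎

  sumTo-extend : ∀ {m n} (f : ℕ → Carrier) → m ℕ.≤ n → (∀ i → m ℕ.< i → f i ≈ 0#) →
                 sumTo n f ≈ sumTo m f
  sumTo-extend {m} f m≤n f≈0 = extend (ℕₚ.≤⇒≤′ m≤n)
    where
    extend : ∀ {n} → m ℕ.≤′ n → sumTo n f ≈ sumTo m f
    extend ℕ.≤′-refl        = refl
    extend (ℕ.≤′-step m≤′n) =
      trans (+-congˡ (f≈0 _ (ℕ.s≤s (ℕₚ.≤′⇒≤ m≤′n)))) (trans (+-identityʳ _) (extend m≤′n))

  sumTo-reverse : ∀ n (f : ℕ → Carrier) → sumTo n f ≈ sumTo n (λ i → f (n ℕ.∸ i))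
  sumTo-reverse zero    f = refl
  sumTo-reverse (suc n) f = begin
    sumTo n f + f (suc n)                     ≈⟨ +-comm _ _ ⟩
    f (suc n) + sumTo n f                     ≈⟨ +-congˡ (sumTo-reverse n f) ⟩
    f (suc n) + sumTo n (λ i → f (n ℕ.∸ i))   ≈⟨ sumTo-suc n (λ i → f (suc n ℕ.∸ i)) ⟨
    sumTo (suc n) (λ i → f (suc n ℕ.∸ i))     ∎

  sumTo-swap : ∀ m n (F : ℕ → ℕ → Carrier) →
               sumTo m (λ i → sumTo n (F i)) ≈ sumTo n (λ j → sumTo m (λ i → F i j))
  sumTo-swap zero    n F = refl
  sumTo-swap (suc m) n F = trans (+-congʳ (sumTo-swap m n F)) (sym (sumTo-+ n _ _))

module PowerSeriesRing {c ℓ} (R : CommutativeRing c ℓ) where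
  open CommutativeRing R
  open Series R
  open FiniteSums R
  module ≈-Reasoning = Relation.Binary.Reasoning.Setoid setoid
  open ≈-Reasoning

  infixl 6 _⊞_
  infix  8 ⊟_

  _⊞_ : PS → PS → PS
  (f ⊞ g) n = f n + g n

  ⊟_ : PS → PS
  (⊟ f) n = - f n

  zeroS : PS
  zeroS _ = 0#

  constS : Carrier → PS
  constS a zero    = a
  constS a (suc n) = 0#

  shift : PS → PS
  shift f n = f (suc n)

  ≋-refl : ∀ {f} → f ≋ f
  ≋-refl n = refl

  ≋-sym : ∀ {f g} → f ≋ g → g ≋ f
  ≋-sym f≋g n = sym (f≋g n)

  ≋-trans : ∀ {f g h} → f ≋ g → g ≋ h → f ≋ h
  ≋-trans f≋g g≋h n = trans (f≋g n) (g≋h n)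

  ⊞-cong : ∀ {f f′ g g′} → f ≋ f′ → g ≋ g′ → (f ⊞ g) ≋ (f′ ⊞ g′)
  ⊞-cong f≋f′ g≋g′ n = +-cong (f≋f′ n) (g≋g′ n)

  ⊞-congˡ : ∀ f {g g′} → g ≋ g′ → (f ⊞ g) ≋ (f ⊞ g′)
  ⊞-congˡ f = ⊞-cong (≋-refl {f})

  ⊟-cong : ∀ {f g} → f ≋ g → (⊟ f) ≋ (⊟ g)
  ⊟-cong f≋g n = -‿cong (f≋g n)

  ·-cong : ∀ {f f′ g g′} → f ≋ f′ → g ≋ g′ → (f · g) ≋ (f′ · g′)
  ·-cong f≋f′ g≋g′ n = sumTo-cong n (λ i _ → *-cong (f≋f′ i) (g≋g′ (n ℕ.∸ i)))

  ·-congˡ : ∀ f {g g′} → g ≋ g′ → (f · g) ≋ (f · g′)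
  ·-congˡ f = ·-cong (≋-refl {f})

  ·-congʳ : ∀ g {f f′} → f ≋ f′ → (f · g) ≋ (f′ · g)
  ·-congʳ g f≋f′ = ·-cong f≋f′ (≋-refl {g})

  ·-comm : ∀ f g → (f · g) ≋ (g · f)
  ·-comm f g n = trans (sumTo-reverse n _) (sumTo-cong n (λ i i≤n →
    trans (*-comm _ _) (*-congʳ (reflexive (≡.cong g (ℕₚ.m∸[m∸n]≡n i≤n))))))

  ·-distribˡ : ∀ f g h → (f · (g ⊞ h)) ≋ ((f · g) ⊞ (f · h))
  ·-distribˡ f g h n = trans (sumTo-cong n (λ i _ → distribˡ _ _ _)) (sumTo-+ n _ _)

  ·-distribʳ : ∀ f g h → ((g ⊞ h) · f) ≋ ((g · f) ⊞ (h · f))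
  ·-distribʳ f g h n = begin
    ((g ⊞ h) · f) n         ≈⟨ ·-comm (g ⊞ h) f n ⟩
    (f · (g ⊞ h)) n         ≈⟨ ·-distribˡ f g h n ⟩
    (f · g) n + (f · h) n   ≈⟨ +-cong (·-comm f g n) (·-comm f h n) ⟩
    (g · f) n + (h · f) n   ∎

  constS-·-coeff : ∀ a f n → (constS a · f) n ≈ a * f n
  constS-·-coeff a f n = sumTo-head n (λ _ _ → zeroˡ _)

  ·-suc : ∀ f g n → (f · g) (suc n) ≈ f 0 * g (suc n) + (shift f · g) n
  ·-suc f g n = sumTo-suc n _

  shift-· : ∀ f g → shift (f · g) ≋ ((constS (f 0) · shift g) ⊞ (shift f · g))
  shift-· f g n = trans (·-suc f g n) (+-congʳ (sym (constS-·-coeff (f 0) (shift g) n)))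

  ·-assoc : ∀ f g h → ((f · g) · h) ≋ (f · (g · h))
  ·-assoc f g h zero    = *-assoc _ _ _
  ·-assoc f g h (suc n) = begin
    ((f · g) · h) (suc n)
      ≈⟨ ·-suc (f · g) h n ⟩
    (f 0 * g 0) * h (suc n) + (shift (f · g) · h) n
      ≈⟨ +-congˡ (·-congʳ h (shift-· f g) n) ⟩
    (f 0 * g 0) * h (suc n) + (((constS (f 0) · shift g) ⊞ (shift f · g)) · h) n
      ≈⟨ +-congˡ (·-distribʳ h _ _ n) ⟩
    (f 0 * g 0) * h (suc n) + (((constS (f 0) · shift g) · h) n + ((shift f · g) · h) n)
      ≈⟨ +-congˡ (+-cong (·-assoc (constS (f 0)) (shift g) h n) (·-assoc (shift f) g h n)) ⟩
    (f 0 * g 0) * h (suc n) + ((constS (f 0) · (shift g · h)) n + (shift f · (g · h)) n)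
      ≈⟨ +-congˡ (+-congʳ (constS-·-coeff (f 0) (shift g · h) n)) ⟩
    (f 0 * g 0) * h (suc n) + (f 0 * (shift g · h) n + (shift f · (g · h)) n)
      ≈⟨ regroup _ _ _ _ _ ⟩
    f 0 * (g 0 * h (suc n) + (shift g · h) n) + (shift f · (g · h)) n
      ≈⟨ +-congʳ (*-congˡ (·-suc g h n)) ⟨
    f 0 * (g · h) (suc n) + (shift f · (g · h)) n
      ≈⟨ ·-suc f (g · h) n ⟨
    (f · (g · h)) (suc n) ∎
    where
    open IntegerSolver R
    regroup : ∀ a b x y z → (a * b) * x + (a * y + z) ≈ a * (b * x + y) + z
    regroup = solve 5 (λ a b x y z → (a :* b) :* x :+ (a :* y :+ z) := a :* (b :* x :+ y) :+ z) refl

  ·-identityˡ : ∀ f → (oneS · f) ≋ f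
  ·-identityˡ f n = trans (sumTo-head n (λ _ _ → zeroˡ _)) (*-identityˡ _)

  ·-identityʳ : ∀ f → (f · oneS) ≋ f
  ·-identityʳ f = ≋-trans (·-comm f oneS) (·-identityˡ f)

  PSring : CommutativeRing c ℓ
  PSring = record
    { Carrier = PS
    ; _≈_ = _≋_
    ; _+_ = _⊞_
    ; _*_ = _·_
    ; -_ = ⊟_
    ; 0# = zeroS
    ; 1# = oneS
    ; isCommutativeRing = record
      { isRing = record
        { +-isAbelianGroup = record
          { isGroup = record
            { isMonoid = record
              { isSemigroup = record
                { isMagma = record
                  { isEquivalence = record { refl = ≋-refl ; sym = ≋-sym ; trans = ≋-trans }
                  ; ∙-cong = ⊞-cong }
                ; assoc = λ _ _ _ _ → +-assoc _ _ _ }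
              ; identity = (λ _ _ → +-identityˡ _) , (λ _ _ → +-identityʳ _) }
            ; inverse = (λ _ _ → -‿inverseˡ _) , (λ _ _ → -‿inverseʳ _)
            ; ⁻¹-cong = ⊟-cong }
          ; comm = λ _ _ _ → +-comm _ _ }
        ; *-cong = ·-cong
        ; *-assoc = ·-assoc
        ; *-identity = ·-identityˡ , ·-identityʳ
        ; distrib = ·-distribˡ , ·-distribʳ }
      ; *-comm = ·-comm } }

  module ≋-Reasoning = Relation.Binary.Reasoning.Setoid (CommutativeRing.setoid PSring)

  oneS≋constS : oneS ≋ constS 1#
  oneS≋constS zero    = refl
  oneS≋constS (suc n) = refl

  constS≈0 : ∀ {a} → a ≈ 0# → constS a ≋ zeroS
  constS≈0 a≈0 zero    = a≈0
  constS≈0 a≈0 (suc n) = refl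

  tS·-zero : ∀ f → (tS · f) 0 ≈ 0#
  tS·-zero f = zeroˡ _

  tS·-suc : ∀ f n → (tS · f) (suc n) ≈ f n
  tS·-suc f n = begin
    (tS · f) (suc n)                    ≈⟨ ·-suc tS f n ⟩
    0# * f (suc n) + (shift tS · f) n   ≈⟨ +-cong (zeroˡ _) (sumTo-head n (λ _ _ → zeroˡ _)) ⟩
    0# + 1# * f n                       ≈⟨ +-identityˡ _ ⟩
    1# * f n                            ≈⟨ *-identityˡ _ ⟩
    f n                                 ∎

  tS·-cancel : ∀ {f g} → (tS · f) ≋ (tS · g) → f ≋ g
  tS·-cancel {f} {g} tf≋tg n = trans (sym (tS·-suc f n)) (trans (tf≋tg (suc n)) (tS·-suc g n))

  constS+tS·shift : ∀ f → f ≋ (constS (f 0) ⊞ (tS · shift f))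
  constS+tS·shift f zero    = sym (trans (+-congˡ (tS·-zero (shift f))) (+-identityʳ _))
  constS+tS·shift f (suc n) = sym (trans (+-congˡ (tS·-suc (shift f) n)) (+-identityˡ _))

  1+[_]t : Carrier → PS
  1+[ p ]t = oneS ⊞ (constS p · tS)

  1+[]t·-coeff : ∀ p f n → (1+[ p ]t · f) n ≈ f n + p * (tS · f) n
  1+[]t·-coeff p f n = begin
    (1+[ p ]t · f) n                         ≈⟨ ·-distribʳ f oneS (constS p · tS) n ⟩
    (oneS · f) n + ((constS p · tS) · f) n   ≈⟨ +-cong (·-identityˡ f n) (·-assoc (constS p) tS f n) ⟩
    f n + (constS p · (tS · f)) n            ≈⟨ +-congˡ (constS-·-coeff p (tS · f) n) ⟩
    f n + p * (tS · f) n                     ∎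

  1-t·-coeff : ∀ f n → ((oneS -S tS) · f) n ≈ f n - (tS · f) n
  1-t·-coeff f = solve 2 (λ t f → (con (+ 1) :- t) :* f := f :- t :* f) ≋-refl tS f
    where open IntegerSolver PSring

  ·-congˡ-< : ∀ {h f g} n → h 0 ≈ 0# → (∀ {m} → m ℕ.< n → f m ≈ g m) → (h · f) n ≈ (h · g) n
  ·-congˡ-< n h0≈0 f≈g = sumTo-cong n λ where
    zero    _   → trans (*-congʳ h0≈0) (trans (zeroˡ _) (sym (trans (*-congʳ h0≈0) (zeroˡ _))))
    (suc i) i<n → *-congˡ (f≈g (ℕₚ.∸-monoʳ-< (ℕ.s≤s ℕ.z≤n) i<n))

  unique-solution : ∀ {a} {A : Set a} (next : A → A) (d : A → PS) {h} → h 0 ≈ 0# →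
                    {Φ Ψ : A → PS} →
                    (∀ x → Φ x ≋ (d x ⊞ (h · Φ (next x)))) →
                    (∀ x → Ψ x ≋ (d x ⊞ (h · Ψ (next x)))) →
                    ∀ x → Φ x ≋ Ψ x
  unique-solution next d {h} h0≈0 {Φ} {Ψ} Φ-eq Ψ-eq x n = <-rec P step n x
    where
    P : ℕ → Set _
    P n = ∀ x → Φ x n ≈ Ψ x n
    step : ∀ n → (∀ {m} → m ℕ.< n → P m) → P n
    step n ih x = begin
      Φ x n                        ≈⟨ Φ-eq x n ⟩
      d x n + (h · Φ (next x)) n   ≈⟨ +-congˡ (·-congˡ-< n h0≈0 (λ m<n → ih m<n (next x))) ⟩
      d x n + (h · Ψ (next x)) n   ≈⟨ Ψ-eq x n ⟨
      Ψ x n                        ∎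

module Derivative {c ℓ} (R : CommutativeRing c ℓ) where
  open CommutativeRing R
  open Series R
  open FiniteSums R
  open PowerSeriesRing R
  open FromℕProperties R using (fromℕ-+)

  ∂ : PS → PS
  ∂ f n = fromℕ (suc n) * f (suc n)

  θ : PS → PS
  θ f n = fromℕ n * f n

  ∂-cong : ∀ {f g} → f ≋ g → ∂ f ≋ ∂ g
  ∂-cong f≋g n = *-congˡ (f≋g (suc n))

  ∂-⊞ : ∀ f g → ∂ (f ⊞ g) ≋ (∂ f ⊞ ∂ g)
  ∂-⊞ f g n = distribˡ _ _ _

  ∂-⊟ : ∀ f → ∂ (⊟ f) ≋ (⊟ ∂ f)
  ∂-⊟ f n = sym (-‿distribʳ-* _ _)
    where open import Algebra.Properties.Ring ring using (-‿distribʳ-*)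

  ∂-constS : ∀ a → ∂ (constS a) ≋ zeroS
  ∂-constS a n = zeroʳ _

  ∂-tS : ∂ tS ≋ oneS
  ∂-tS zero    = trans (*-identityʳ _) (+-identityʳ _)
  ∂-tS (suc n) = zeroʳ _

  tS·∂ : ∀ f → (tS · ∂ f) ≋ θ f
  tS·∂ f zero    = trans (tS·-zero (∂ f)) (sym (zeroˡ _))
  tS·∂ f (suc n) = tS·-suc (∂ f) n

  ∂≋shift+tS·∂shift : ∀ f → ∂ f ≋ (shift f ⊞ (tS · ∂ (shift f)))
  ∂≋shift+tS·∂shift f n = begin
    (1# + fromℕ n) * f (suc n)             ≈⟨ distribʳ _ _ _ ⟩
    1# * f (suc n) + fromℕ n * f (suc n)   ≈⟨ +-cong (*-identityˡ _) (sym (tS·∂ (shift f) n)) ⟩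
    shift f n + (tS · ∂ (shift f)) n       ∎
    where open ≈-Reasoning

  θ-· : ∀ f g → θ (f · g) ≋ ((θ f · g) ⊞ (f · θ g))
  θ-· f g n = begin
    fromℕ n * sumTo n (λ i → f i * g (n ℕ.∸ i))
      ≈⟨ *-sumTo n _ _ ⟩
    sumTo n (λ i → fromℕ n * (f i * g (n ℕ.∸ i)))
      ≈⟨ sumTo-cong n split ⟩
    sumTo n (λ i → (fromℕ i * f i) * g (n ℕ.∸ i) + f i * (fromℕ (n ℕ.∸ i) * g (n ℕ.∸ i)))
      ≈⟨ sumTo-+ n _ _ ⟩
    (θ f · g) n + (f · θ g) n ∎
    where
    open ≈-Reasoning
    open IntegerSolver R
    distribute : ∀ a b x y → (a + b) * (x * y) ≈ (a * x) * y + x * (b * y)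
    distribute = solve 4 (λ a b x y → (a :+ b) :* (x :* y) := (a :* x) :* y :+ x :* (b :* y)) refl
    split : ∀ i → i ℕ.≤ n → fromℕ n * (f i * g (n ℕ.∸ i)) ≈
                             (fromℕ i * f i) * g (n ℕ.∸ i) + f i * (fromℕ (n ℕ.∸ i) * g (n ℕ.∸ i))
    split i i≤n = trans (*-congʳ n≈i+[n∸i]) (distribute _ _ _ _)
      where
      n≈i+[n∸i] : fromℕ n ≈ fromℕ i + fromℕ (n ℕ.∸ i)
      n≈i+[n∸i] = trans (reflexive (≡.cong fromℕ (≡.sym (ℕₚ.m+[n∸m]≡n i≤n)))) (fromℕ-+ i (n ℕ.∸ i))

  ∂-· : ∀ f g → ∂ (f · g) ≋ ((∂ f · g) ⊞ (f · ∂ g))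
  ∂-· f g = tS·-cancel (begin
    tS · ∂ (f · g)                        ≈⟨ tS·∂ (f · g) ⟩
    θ (f · g)                             ≈⟨ θ-· f g ⟩
    (θ f · g) ⊞ (f · θ g)                 ≈⟨ ⊞-cong (·-congʳ g (tS·∂ f)) (·-congˡ f (tS·∂ g)) ⟨
    ((tS · ∂ f) · g) ⊞ (f · (tS · ∂ g))   ≈⟨ factor-tS tS (∂ f) g f (∂ g) ⟩
    tS · ((∂ f · g) ⊞ (f · ∂ g))          ∎)
    where
    open ≋-Reasoning
    open IntegerSolver PSring
    factor-tS : ∀ t a g f b → (((t · a) · g) ⊞ (f · (t · b))) ≋ (t · ((a · g) ⊞ (f · b)))
    factor-tS = solve 5 (λ t a g f b → (t :* a) :* g :+ f :* (t :* b) := t :* (a :* g :+ f :* b)) ≋-refl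

module Composition {c ℓ} (R : CommutativeRing c ℓ) where
  open CommutativeRing R
  open Series R
  open FiniteSums R
  open PowerSeriesRing R
  open Derivative R

  comp-zero : ∀ g h → comp g h 0 ≈ g 0
  comp-zero g h = *-identityʳ _

  comp-congˡ : ∀ {f g} h → f ≋ g → comp f h ≋ comp g h
  comp-congˡ h f≋g n = sumTo-cong n (λ k _ → *-congʳ (f≋g k))

  comp-congʳ : ∀ g {h h′} → h ≋ h′ → comp g h ≋ comp g h′
  comp-congʳ g {h} {h′} h≋h′ n = sumTo-cong n (λ k _ → *-congˡ (powS-cong k n))
    where
    powS-cong : ∀ k → powS h k ≋ powS h′ k
    powS-cong zero    = ≋-refl
    powS-cong (suc k) = ·-cong h≋h′ (powS-cong k)

  comp-⊞ : ∀ f g h → comp (f ⊞ g) h ≋ (comp f h ⊞ comp g h)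
  comp-⊞ f g h n = trans (sumTo-cong n (λ k _ → distribʳ _ _ _)) (sumTo-+ n _ _)

  comp-⊟ : ∀ f h → comp (⊟ f) h ≋ (⊟ comp f h)
  comp-⊟ f h n = trans (sumTo-cong n (λ k _ → sym (-‿distribˡ-* _ _))) (sym (-‿sumTo n _))
    where open import Algebra.Properties.Ring ring using (-‿distribˡ-*)

  comp-constS· : ∀ a f h → comp (constS a · f) h ≋ (constS a · comp f h)
  comp-constS· a f h n = begin
    sumTo n (λ k → (constS a · f) k * powS h k n)
      ≈⟨ sumTo-cong n (λ k _ → *-congʳ (constS-·-coeff a f k)) ⟩
    sumTo n (λ k → (a * f k) * powS h k n)
      ≈⟨ sumTo-cong n (λ k _ → *-assoc _ _ _) ⟩
    sumTo n (λ k → a * (f k * powS h k n))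
      ≈⟨ *-sumTo n a _ ⟨
    a * comp f h n
      ≈⟨ constS-·-coeff a (comp f h) n ⟨
    (constS a · comp f h) n ∎
    where open ≈-Reasoning

  comp-constS : ∀ a h → comp (constS a) h ≋ constS a
  comp-constS a h n = trans (sumTo-head n (λ _ _ → zeroˡ _)) (a*oneS n)
    where
    a*oneS : ∀ n → a * oneS n ≈ constS a n
    a*oneS zero    = *-identityʳ _
    a*oneS (suc n) = zeroʳ _

  comp-oneS : ∀ h → comp oneS h ≋ oneS
  comp-oneS h = ≋-trans (comp-congˡ h oneS≋constS) (≋-trans (comp-constS 1# h) (≋-sym oneS≋constS))

  powS-vanishes : ∀ {h} → h 0 ≈ 0# → ∀ k {n} → n ℕ.< k → powS h k n ≈ 0#
  powS-vanishes {h} h0≈0 (suc k) {n} n<1+k = begin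
    (h · powS h k) n   ≈⟨ ·-congˡ-< n h0≈0 below ⟩
    (h · zeroS) n      ≈⟨ sumTo-zero n (λ _ _ → zeroʳ _) ⟩
    0#                 ∎
    where
    open ≈-Reasoning
    below : ∀ {m} → m ℕ.< n → powS h k m ≈ 0#
    below m<n = powS-vanishes {h} h0≈0 k (ℕₚ.<-≤-trans m<n (ℕₚ.≤-pred n<1+k))

  comp-extend : ∀ g {h} → h 0 ≈ 0# → ∀ {n N} → n ℕ.≤ N →
                comp g h n ≈ sumTo N (λ k → g k * powS h k n)
  comp-extend g h0≈0 n≤N =
    sym (sumTo-extend _ n≤N (λ k n<k → trans (*-congˡ (powS-vanishes h0≈0 k n<k)) (zeroʳ _)))

  ·-comp : ∀ g {h} → h 0 ≈ 0# → ∀ n → (h · comp g h) n ≈ sumTo n (λ k → g k * powS h (suc k) n)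
  ·-comp g {h} h0≈0 n = begin
    sumTo n (λ i → h i * comp g h (n ℕ.∸ i))
      ≈⟨ sumTo-cong n (λ i _ → *-congˡ (comp-extend g h0≈0 (ℕₚ.m∸n≤m n i))) ⟩
    sumTo n (λ i → h i * sumTo n (λ k → g k * powS h k (n ℕ.∸ i)))
      ≈⟨ sumTo-cong n (λ i _ → trans (*-sumTo n _ _) (sumTo-cong n (λ k _ → x∙yz≈y∙xz _ _ _))) ⟩
    sumTo n (λ i → sumTo n (λ k → g k * (h i * powS h k (n ℕ.∸ i))))
      ≈⟨ sumTo-swap n n _ ⟩
    sumTo n (λ k → sumTo n (λ i → g k * (h i * powS h k (n ℕ.∸ i))))
      ≈⟨ sumTo-cong n (λ k _ → *-sumTo n (g k) _) ⟨
    sumTo n (λ k → g k * powS h (suc k) n) ∎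
    where
    open ≈-Reasoning
    open import Algebra.Properties.CommutativeSemigroup *-commutativeSemigroup using (x∙yz≈y∙xz)

  comp-horner : ∀ f {h} → h 0 ≈ 0# → comp f h ≋ (constS (f 0) ⊞ (h · comp (shift f) h))
  comp-horner f {h} h0≈0 zero = begin
    f 0 * 1#                         ≈⟨ *-identityʳ _ ⟩
    f 0                              ≈⟨ +-identityʳ _ ⟨
    f 0 + 0#                         ≈⟨ +-congˡ (trans (*-congʳ h0≈0) (zeroˡ _)) ⟨
    f 0 + (h · comp (shift f) h) 0   ∎
    where open ≈-Reasoning
  comp-horner f {h} h0≈0 (suc n) = begin
    comp f h (suc n)
      ≈⟨ comp-extend f h0≈0 (ℕₚ.n≤1+n (suc n)) ⟩
    sumTo (suc (suc n)) (λ k → f k * powS h k (suc n))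
      ≈⟨ sumTo-suc (suc n) _ ⟩
    f 0 * 0# + sumTo (suc n) (λ k → f (suc k) * powS h (suc k) (suc n))
      ≈⟨ +-cong (zeroʳ _) (sym (·-comp (shift f) h0≈0 (suc n))) ⟩
    0# + (h · comp (shift f) h) (suc n) ∎
    where open ≈-Reasoning

  comp-tS· : ∀ f {h} → h 0 ≈ 0# → comp (tS · f) h ≋ (h · comp f h)
  comp-tS· f {h} h0≈0 = begin
    comp (tS · f) h
      ≈⟨ comp-horner (tS · f) h0≈0 ⟩
    constS ((tS · f) 0) ⊞ (h · comp (shift (tS · f)) h)
      ≈⟨ ⊞-cong (constS≈0 (tS·-zero f)) (·-congˡ h (comp-congˡ h (tS·-suc f))) ⟩
    zeroS ⊞ (h · comp f h)
      ≈⟨ (λ _ → +-identityˡ _) ⟩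
    h · comp f h ∎
    where open ≋-Reasoning

  comp-tSˡ : ∀ {h} → h 0 ≈ 0# → comp tS h ≋ h
  comp-tSˡ {h} h0≈0 = begin
    comp tS h            ≈⟨ comp-congˡ h (·-identityʳ tS) ⟨
    comp (tS · oneS) h   ≈⟨ comp-tS· oneS h0≈0 ⟩
    h · comp oneS h      ≈⟨ ·-congˡ h (comp-oneS h) ⟩
    h · oneS             ≈⟨ ·-identityʳ h ⟩
    h                    ∎
    where open ≋-Reasoning

  comp-1+[]t : ∀ p {h} → h 0 ≈ 0# → comp 1+[ p ]t h ≋ (oneS ⊞ (constS p · h))
  comp-1+[]t p {h} h0≈0 = begin
    comp (oneS ⊞ (constS p · tS)) h
      ≈⟨ comp-⊞ oneS (constS p · tS) h ⟩
    comp oneS h ⊞ comp (constS p · tS) h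
      ≈⟨ ⊞-cong (comp-oneS h) (≋-trans (comp-constS· p tS h) (·-congˡ (constS p) (comp-tSˡ h0≈0))) ⟩
    oneS ⊞ (constS p · h) ∎
    where open ≋-Reasoning

  comp-tSʳ : ∀ g → comp g tS ≋ g
  comp-tSʳ = unique-solution shift (λ g → constS (g 0)) refl (λ g → comp-horner g refl) constS+tS·shift

  comp-· : ∀ f g {h} → h 0 ≈ 0# → comp (f · g) h ≋ (comp f h · comp g h)
  comp-· f g {h} h0≈0 =
    unique-solution shift (λ f → constS (f 0) · comp g h) h0≈0 product-horner factor-horner f
    where
    open ≋-Reasoning
    open IntegerSolver PSring
    product-horner : ∀ f → comp (f · g) h ≋ ((constS (f 0) · comp g h) ⊞ (h · comp (shift f · g) h))
    product-horner f = begin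
      comp (f · g) h
        ≈⟨ comp-congˡ h (·-congʳ g (constS+tS·shift f)) ⟩
      comp ((constS (f 0) ⊞ (tS · shift f)) · g) h
        ≈⟨ comp-congˡ h (solve 4 (λ c t f′ g → (c :+ t :* f′) :* g := c :* g :+ t :* (f′ :* g)) ≋-refl
                           (constS (f 0)) tS (shift f) g) ⟩
      comp ((constS (f 0) · g) ⊞ (tS · (shift f · g))) h
        ≈⟨ comp-⊞ _ _ h ⟩
      comp (constS (f 0) · g) h ⊞ comp (tS · (shift f · g)) h
        ≈⟨ ⊞-cong (comp-constS· (f 0) g h) (comp-tS· (shift f · g) h0≈0) ⟩
      (constS (f 0) · comp g h) ⊞ (h · comp (shift f · g) h) ∎
    factor-horner : ∀ f → (comp f h · comp g h) ≋
                          ((constS (f 0) · comp g h) ⊞ (h · (comp (shift f) h · comp g h)))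
    factor-horner f = begin
      comp f h · comp g h
        ≈⟨ ·-congʳ (comp g h) (comp-horner f h0≈0) ⟩
      (constS (f 0) ⊞ (h · comp (shift f) h)) · comp g h
        ≈⟨ solve 4 (λ c h x y → (c :+ h :* x) :* y := c :* y :+ h :* (x :* y)) ≋-refl
             (constS (f 0)) h (comp (shift f) h) (comp g h) ⟩
      (constS (f 0) · comp g h) ⊞ (h · (comp (shift f) h · comp g h)) ∎

  comp-assoc : ∀ g {u v} → u 0 ≈ 0# → v 0 ≈ 0# → comp (comp g u) v ≋ comp g (comp u v)
  comp-assoc g {u} {v} u0≈0 v0≈0 =
    unique-solution shift (λ g → constS (g 0)) uv0≈0 inner-horner (λ g → comp-horner g uv0≈0) g
    where
    open ≋-Reasoning
    uv0≈0 : comp u v 0 ≈ 0#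
    uv0≈0 = trans (comp-zero u v) u0≈0
    inner-horner : ∀ g → comp (comp g u) v ≋ (constS (g 0) ⊞ (comp u v · comp (comp (shift g) u) v))
    inner-horner g = begin
      comp (comp g u) v
        ≈⟨ comp-congˡ v (comp-horner g u0≈0) ⟩
      comp (constS (g 0) ⊞ (u · comp (shift g) u)) v
        ≈⟨ comp-⊞ _ _ v ⟩
      comp (constS (g 0)) v ⊞ comp (u · comp (shift g) u) v
        ≈⟨ ⊞-cong (comp-constS (g 0) v) (comp-· u _ v0≈0) ⟩
      constS (g 0) ⊞ (comp u v · comp (comp (shift g) u) v) ∎

  ∂-comp : ∀ f {h} → h 0 ≈ 0# → ∂ (comp f h) ≋ (comp (∂ f) h · ∂ h)
  ∂-comp f {h} h0≈0 =
    unique-solution shift (λ f → comp (shift f) h · ∂ h) h0≈0 outer-horner inner-horner f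
    where
    open ≋-Reasoning
    open IntegerSolver PSring
    outer-horner : ∀ f → ∂ (comp f h) ≋ ((comp (shift f) h · ∂ h) ⊞ (h · ∂ (comp (shift f) h)))
    outer-horner f = begin
      ∂ (comp f h)
        ≈⟨ ∂-cong (comp-horner f h0≈0) ⟩
      ∂ (constS (f 0) ⊞ (h · comp (shift f) h))
        ≈⟨ ∂-⊞ (constS (f 0)) (h · comp (shift f) h) ⟩
      ∂ (constS (f 0)) ⊞ ∂ (h · comp (shift f) h)
        ≈⟨ ⊞-cong (∂-constS (f 0)) (∂-· h (comp (shift f) h)) ⟩
      zeroS ⊞ ((∂ h · comp (shift f) h) ⊞ (h · ∂ (comp (shift f) h)))
        ≈⟨ solve 4 (λ h′ c h x → con (+ 0) :+ (h′ :* c :+ h :* x) := c :* h′ :+ h :* x) ≋-refl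
             (∂ h) (comp (shift f) h) h (∂ (comp (shift f) h)) ⟩
      (comp (shift f) h · ∂ h) ⊞ (h · ∂ (comp (shift f) h)) ∎
    inner-horner : ∀ f → (comp (∂ f) h · ∂ h) ≋
                         ((comp (shift f) h · ∂ h) ⊞ (h · (comp (∂ (shift f)) h · ∂ h)))
    inner-horner f = begin
      comp (∂ f) h · ∂ h
        ≈⟨ ·-congʳ (∂ h) (comp-congˡ h (∂≋shift+tS·∂shift f)) ⟩
      comp (shift f ⊞ (tS · ∂ (shift f))) h · ∂ h
        ≈⟨ ·-congʳ (∂ h) (≋-trans (comp-⊞ _ _ h) (⊞-congˡ _ (comp-tS· (∂ (shift f)) h0≈0))) ⟩
      (comp (shift f) h ⊞ (h · comp (∂ (shift f)) h)) · ∂ h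
        ≈⟨ solve 4 (λ c h x h′ → (c :+ h :* x) :* h′ := c :* h′ :+ h :* (x :* h′)) ≋-refl
             (comp (shift f) h) h (comp (∂ (shift f)) h) (∂ h) ⟩
      (comp (shift f) h · ∂ h) ⊞ (h · (comp (∂ (shift f)) h · ∂ h)) ∎

IsReciprocal : ∀ {c ℓ} (R : CommutativeRing c ℓ) → (ℕ → CommutativeRing.Carrier R) → Set ℓ
IsReciprocal R inv = ∀ n → fromℕ (suc n) * inv (suc n) ≈ 1#
  where
  open CommutativeRing R
  open Series R

module Reciprocals {c ℓ} (R : CommutativeRing c ℓ)
  (inv : ℕ → CommutativeRing.Carrier R) (fromℕ-suc-*-inv : IsReciprocal R inv) where
  open CommutativeRing R
  open Series R
  open PowerSeriesRing R using (module ≈-Reasoning)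
  open FromℕProperties R using (fromℕ-*)
  open ≈-Reasoning

  fromℕ-*-inv : ∀ {k} → 1 ℕ.≤ k → fromℕ k * inv k ≈ 1#
  fromℕ-*-inv {suc k} _ = fromℕ-suc-*-inv k

  fromℕ-cancel : ∀ k {x y} → 1 ℕ.≤ k → fromℕ k * x ≈ fromℕ k * y → x ≈ y
  fromℕ-cancel k {x} {y} 1≤k kx≈ky = begin
    x                       ≈⟨ *-identityˡ x ⟨
    1# * x                  ≈⟨ *-congʳ (trans (*-comm _ _) (fromℕ-*-inv 1≤k)) ⟨
    (inv k * fromℕ k) * x   ≈⟨ *-assoc _ _ _ ⟩
    inv k * (fromℕ k * x)   ≈⟨ *-congˡ kx≈ky ⟩
    inv k * (fromℕ k * y)   ≈⟨ *-assoc _ _ _ ⟨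
    (inv k * fromℕ k) * y   ≈⟨ *-congʳ (trans (*-comm _ _) (fromℕ-*-inv 1≤k)) ⟩
    1# * y                  ≈⟨ *-identityˡ y ⟩
    y                       ∎

  inv-1 : inv 1 ≈ 1#
  inv-1 = trans (sym (*-identityˡ _)) (trans (*-congʳ (sym (+-identityʳ 1#))) (fromℕ-suc-*-inv 0))

  fromℕ-suc-*-inv-! : ∀ n → fromℕ (suc n) * inv (suc n !) ≈ inv (n !)
  fromℕ-suc-*-inv-! n = fromℕ-cancel (n !) (ℕₚ.1≤n! n) (begin
    fromℕ (n !) * (fromℕ (suc n) * inv (suc n !))   ≈⟨ x∙yz≈yx∙z _ _ _ ⟩
    (fromℕ (suc n) * fromℕ (n !)) * inv (suc n !)   ≈⟨ *-congʳ (fromℕ-* (suc n) (n !)) ⟨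
    fromℕ (suc n !) * inv (suc n !)                 ≈⟨ fromℕ-*-inv (ℕₚ.1≤n! (suc n)) ⟩
    1#                                              ≈⟨ fromℕ-*-inv (ℕₚ.1≤n! n) ⟨
    fromℕ (n !) * inv (n !)                         ∎)
    where open import Algebra.Properties.CommutativeSemigroup *-commutativeSemigroup using (x∙yz≈yx∙z)

  inv-suc-! : ∀ n → inv (suc n) * inv (n !) ≈ inv (suc n !)
  inv-suc-! n = begin
    inv (suc n) * inv (n !)                           ≈⟨ *-congˡ (fromℕ-suc-*-inv-! n) ⟨
    inv (suc n) * (fromℕ (suc n) * inv (suc n !))     ≈⟨ *-assoc _ _ _ ⟨
    (inv (suc n) * fromℕ (suc n)) * inv (suc n !)     ≈⟨ *-congʳ (trans (*-comm _ _) (fromℕ-suc-*-inv n)) ⟩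
    1# * inv (suc n !)                                ≈⟨ *-identityˡ _ ⟩
    inv (suc n !)                                     ∎

module LinearODE {c ℓ} (R : CommutativeRing c ℓ)
  (inv : ℕ → CommutativeRing.Carrier R) (fromℕ-suc-*-inv : IsReciprocal R inv) where
  open CommutativeRing R
  open Series R
  open PowerSeriesRing R
  open Derivative R
  open Reciprocals R inv fromℕ-suc-*-inv
  open ≈-Reasoning

  ode-unique : ∀ p q {f g} → (1+[ p ]t · ∂ f) ≋ (constS q · f) → (1+[ p ]t · ∂ g) ≋ (constS q · g) →
               f 0 ≈ g 0 → f ≋ g
  ode-unique p q {f} {g} f-ode g-ode f0≈g0 = agree
    where
    open IntegerSolver R
    solve-for : ∀ x y z → x + y ≈ z → x ≈ z - y
    solve-for x y z x+y≈z = trans (solve 2 (λ x y → x := (x :+ y) :- y) refl x y) (+-congʳ x+y≈z)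
    recurrence : ∀ h → (1+[ p ]t · ∂ h) ≋ (constS q · h) → ∀ n →
                 fromℕ (suc n) * h (suc n) ≈ q * h n - p * (fromℕ n * h n)
    recurrence h h-ode n = solve-for (∂ h n) (p * θ h n) (q * h n) (begin
      ∂ h n + p * θ h n             ≈⟨ +-congˡ (*-congˡ (tS·∂ h n)) ⟨
      ∂ h n + p * (tS · ∂ h) n      ≈⟨ 1+[]t·-coeff p (∂ h) n ⟨
      (1+[ p ]t · ∂ h) n            ≈⟨ h-ode n ⟩
      (constS q · h) n              ≈⟨ constS-·-coeff q h n ⟩
      q * h n                       ∎)
    agree : f ≋ g
    agree zero    = f0≈g0
    agree (suc n) = fromℕ-cancel (suc n) (ℕ.s≤s ℕ.z≤n) (begin
      fromℕ (suc n) * f (suc n)         ≈⟨ recurrence f f-ode n ⟩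
      q * f n - p * (fromℕ n * f n)     ≈⟨ +-cong (*-congˡ (agree n)) (-‿cong (*-congˡ (*-congˡ (agree n)))) ⟩
      q * g n - p * (fromℕ n * g n)     ≈⟨ recurrence g g-ode n ⟨
      fromℕ (suc n) * g (suc n)         ∎)

module FallingFactorial {c ℓ} (R : CommutativeRing c ℓ) where
  open CommutativeRing R
  open Series R
  open PowerSeriesRing R using (module ≈-Reasoning)

  fall-cong : ∀ {x y} l n → x ≈ y → fall x l n ≈ fall y l n
  fall-cong l zero    x≈y = refl
  fall-cong l (suc n) x≈y = *-cong (fall-cong l n x≈y) (+-congʳ x≈y)

  fall-suc : ∀ x l n → fall x l (suc n) ≈ x * fall (x - l) l n
  fall-suc x l zero    = solve 2 (λ x l → con (+ 1) :* (x :- con (+ 0) :* l) := x :* con (+ 1)) refl x l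
    where open IntegerSolver R
  fall-suc x l (suc n) = begin
    fall x l (suc n) * (x - (1# + fromℕ n) * l)         ≈⟨ *-congʳ (fall-suc x l n) ⟩
    (x * fall (x - l) l n) * (x - (1# + fromℕ n) * l)   ≈⟨ regroup x (fall (x - l) l n) (fromℕ n) l ⟩
    x * (fall (x - l) l n * ((x - l) - fromℕ n * l))    ∎
    where
    open ≈-Reasoning
    open IntegerSolver R
    regroup : ∀ x F m l → (x * F) * (x - (1# + m) * l) ≈ x * (F * ((x - l) - m * l))
    regroup = solve 4 (λ x F m l → (x :* F) :* (x :- (con (+ 1) :+ m) :* l)
                                   := x :* (F :* ((x :- l) :- m :* l))) refl

module DegenerateExponential {c ℓ} (R : CommutativeRing c ℓ)
  (inv : ℕ → CommutativeRing.Carrier R) (fromℕ-suc-*-inv : IsReciprocal R inv)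
  (lam : CommutativeRing.Carrier R) where
  open CommutativeRing R
  open Series R
  open PowerSeriesRing R
  open Derivative R
  open Composition R
  open Reciprocals R inv fromℕ-suc-*-inv
  open FallingFactorial R
  open import Algebra.Properties.CommutativeSemigroup *-commutativeSemigroup using (x∙yz≈y∙xz)

  a : ℕ → Carrier
  a j = 1# - fromℕ j * lam

  -- E j = (1 + λt)^((1 - jλ)/λ).
  E : ℕ → PS
  E j n = fall (a j) lam n * inv (n !)

  a-zero : a 0 ≈ 1#
  a-zero = solve 1 (λ l → con (+ 1) :- con (+ 0) :* l := con (+ 1)) refl lam
    where open IntegerSolver R

  a-suc : ∀ j → a (suc j) ≈ a j - lam
  a-suc j = solve 2 (λ m l → con (+ 1) :- (con (+ 1) :+ m) :* l := (con (+ 1) :- m :* l) :- l) refl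
              (fromℕ j) lam
    where open IntegerSolver R

  ∂E : ∀ j → ∂ (E j) ≋ (constS (a j) · E (suc j))
  ∂E j n = begin
    fromℕ (suc n) * (fall (a j) lam (suc n) * inv (suc n !))
      ≈⟨ x∙yz≈y∙xz _ _ _ ⟩
    fall (a j) lam (suc n) * (fromℕ (suc n) * inv (suc n !))
      ≈⟨ *-cong (fall-suc (a j) lam n) (fromℕ-suc-*-inv-! n) ⟩
    (a j * fall (a j - lam) lam n) * inv (n !)
      ≈⟨ *-assoc _ _ _ ⟩
    a j * (fall (a j - lam) lam n * inv (n !))
      ≈⟨ *-congˡ (*-congʳ (fall-cong lam n (sym (a-suc j)))) ⟩
    a j * E (suc j) n
      ≈⟨ constS-·-coeff (a j) (E (suc j)) n ⟨
    (constS (a j) · E (suc j)) n ∎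
    where open ≈-Reasoning

  ∂E₀ : ∂ (E 0) ≋ E 1
  ∂E₀ n = trans (∂E 0 n) (trans (constS-·-coeff (a 0) (E 1) n) (trans (*-congʳ a-zero) (*-identityˡ _)))

  1+λt·E : ∀ j → (1+[ lam ]t · E (suc j)) ≋ E j
  1+λt·E j zero = begin
    (1+[ lam ]t · E (suc j)) 0               ≈⟨ 1+[]t·-coeff lam (E (suc j)) 0 ⟩
    E (suc j) 0 + lam * (tS · E (suc j)) 0   ≈⟨ +-congˡ (trans (*-congˡ (tS·-zero (E (suc j)))) (zeroʳ _)) ⟩
    E j 0 + 0#                               ≈⟨ +-identityʳ _ ⟩
    E j 0                                    ∎
    where open ≈-Reasoning
  1+λt·E j (suc n) = begin
    (1+[ lam ]t · E (suc j)) (suc n)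
      ≈⟨ 1+[]t·-coeff lam (E (suc j)) (suc n) ⟩
    E (suc j) (suc n) + lam * (tS · E (suc j)) (suc n)
      ≈⟨ +-cong (*-congʳ (*-congˡ (+-congʳ (a-suc j)))) (*-congˡ (tS·-suc (E (suc j)) n)) ⟩
    (F * ((a j - lam) - fromℕ n * lam)) * J + lam * (F * inv (n !))
      ≈⟨ +-congˡ (*-congˡ (*-congˡ (fromℕ-suc-*-inv-! n))) ⟨
    (F * ((a j - lam) - fromℕ n * lam)) * J + lam * (F * (fromℕ (suc n) * J))
      ≈⟨ collect (a j) F lam (fromℕ n) J ⟩
    (a j * F) * J
      ≈⟨ *-congʳ (trans (fall-suc (a j) lam n) (*-congˡ (fall-cong lam n (sym (a-suc j))))) ⟨
    E j (suc n) ∎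
    where
    open ≈-Reasoning
    open IntegerSolver R
    F = fall (a (suc j)) lam n
    J = inv (suc n !)
    collect : ∀ x F l m J → (F * ((x - l) - m * l)) * J + l * (F * ((1# + m) * J)) ≈ (x * F) * J
    collect = solve 5 (λ x F l m J → (F :* ((x :- l) :- m :* l)) :* J :+ l :* (F :* ((con (+ 1) :+ m) :* J))
                                     := (x :* F) :* J) refl

  E·E₁ : ∀ j → (E j · E 1) ≋ (E (suc j) · E 0)
  E·E₁ j = begin
    E j · E 1                        ≈⟨ ·-congʳ (E 1) (1+λt·E j) ⟨
    (1+[ lam ]t · E (suc j)) · E 1   ≈⟨ solve 3 (λ x y z → (x :* y) :* z := y :* (x :* z)) ≋-refl
                                          1+[ lam ]t (E (suc j)) (E 1) ⟩
    E (suc j) · (1+[ lam ]t · E 1)   ≈⟨ ·-congˡ (E (suc j)) (1+λt·E 0) ⟩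
    E (suc j) · E 0                  ∎
    where
    open ≋-Reasoning
    open IntegerSolver PSring

  e u : PS
  e = eλ lam inv
  u = oneS -S e

  e≋E₀ : e ≋ E 0
  e≋E₀ n = *-congʳ (fall-cong lam n (sym a-zero))

  e-zero : e 0 ≈ 1#
  e-zero = trans (*-identityˡ _) inv-1

  u-zero : u 0 ≈ 0#
  u-zero = trans (+-congˡ (-‿cong e-zero)) (-‿inverseʳ 1#)

  ∂u : ∂ u ≋ (⊟ E 1)
  ∂u = begin
    ∂ (oneS ⊞ (⊟ e))   ≈⟨ ∂-⊞ oneS (⊟ e) ⟩
    ∂ oneS ⊞ ∂ (⊟ e)   ≈⟨ ⊞-cong (λ _ → zeroʳ _) (∂-⊟ e) ⟩
    zeroS ⊞ (⊟ ∂ e)    ≈⟨ (λ _ → +-identityˡ _) ⟩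
    ⊟ ∂ e              ≈⟨ ⊟-cong (≋-trans (∂-cong e≋E₀) ∂E₀) ⟩
    ⊟ E 1              ∎
    where open ≋-Reasoning

  1+λt·∂e : (1+[ lam ]t · ∂ e) ≋ e
  1+λt·∂e = begin
    1+[ lam ]t · ∂ e   ≈⟨ ·-congˡ (1+[ lam ]t) (≋-trans (∂-cong e≋E₀) ∂E₀) ⟩
    1+[ lam ]t · E 1   ≈⟨ 1+λt·E 0 ⟩
    E 0                ≈⟨ e≋E₀ ⟨
    e                  ∎
    where open ≋-Reasoning

  comp-1-t-u : comp (oneS -S tS) u ≋ e
  comp-1-t-u = begin
    comp (oneS ⊞ (⊟ tS)) u        ≈⟨ comp-⊞ oneS (⊟ tS) u ⟩
    comp oneS u ⊞ comp (⊟ tS) u   ≈⟨ ⊞-cong (comp-oneS u) (≋-trans (comp-⊟ tS u) (⊟-cong (comp-tSˡ u-zero))) ⟩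
    oneS ⊞ (⊟ (oneS ⊞ (⊟ e)))     ≈⟨ solve 2 (λ o e → o :+ :- (o :- e) := e) ≋-refl oneS e ⟩
    e                             ∎
    where
    open ≋-Reasoning
    open IntegerSolver PSring

module AAlgorithm {c ℓ} (R : CommutativeRing c ℓ)
  (inv : ℕ → CommutativeRing.Carrier R) (fromℕ-suc-*-inv : IsReciprocal R inv)
  (lam : CommutativeRing.Carrier R) where
  open CommutativeRing R
  open Series R
  open PowerSeriesRing R
  open Derivative R
  open Composition R
  open Reciprocals R inv fromℕ-suc-*-inv
  open DegenerateExponential R inv fromℕ-suc-*-inv lam
  open import Algebra.Properties.CommutativeSemigroup *-commutativeSemigroup using (x∙yz≈y∙xz)

  -- bmat lam b (suc j) m unfolds to A-step j (bmat lam b j) m.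
  A-step : ℕ → PS → PS
  A-step j C m = (fromℕ (suc m) - fromℕ j * lam) * C m - fromℕ (suc m) * C (suc m)

  A-step≋ : ∀ j C → A-step j C ≋ ((constS (a j) · C) ⊞ (⊟ ((oneS -S tS) · ∂ C)))
  A-step≋ j C m = begin
    A-step j C m
      ≈⟨ rearrange (fromℕ m) (fromℕ j) lam (C m) (C (suc m)) ⟩
    (1# - fromℕ j * lam) * C m - (fromℕ (suc m) * C (suc m) - fromℕ m * C m)
      ≈⟨ +-cong (constS-·-coeff (a j) C m) (-‿cong (+-congˡ (-‿cong (tS·∂ C m)))) ⟨
    (constS (a j) · C) m - (∂ C m - (tS · ∂ C) m)
      ≈⟨ +-congˡ (-‿cong (1-t·-coeff (∂ C) m)) ⟨
    (constS (a j) · C) m - ((oneS -S tS) · ∂ C) m ∎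
    where
    open ≈-Reasoning
    open IntegerSolver R
    rearrange : ∀ m k l x y → ((1# + m) - k * l) * x - (1# + m) * y ≈
                              (1# - k * l) * x - ((1# + m) * y - m * x)
    rearrange = solve 5 (λ m k l x y → ((con (+ 1) :+ m) :- k :* l) :* x :- (con (+ 1) :+ m) :* y
                                       := (con (+ 1) :- k :* l) :* x :- ((con (+ 1) :+ m) :* y :- m :* x)) refl

  comp-A-step : ∀ j C → comp (A-step j C) u ≋ ((constS (a j) · comp C u) ⊞ (⊟ (E 0 · comp (∂ C) u)))
  comp-A-step j C = begin
    comp (A-step j C) u
      ≈⟨ comp-congˡ u (A-step≋ j C) ⟩
    comp ((constS (a j) · C) ⊞ (⊟ ((oneS -S tS) · ∂ C))) u
      ≈⟨ comp-⊞ (constS (a j) · C) (⊟ ((oneS -S tS) · ∂ C)) u ⟩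
    comp (constS (a j) · C) u ⊞ comp (⊟ ((oneS -S tS) · ∂ C)) u
      ≈⟨ ⊞-cong (comp-constS· (a j) C u) (≋-trans (comp-⊟ _ u) (⊟-cong (comp-· (oneS -S tS) (∂ C) u-zero))) ⟩
    (constS (a j) · comp C u) ⊞ (⊟ (comp (oneS -S tS) u · comp (∂ C) u))
      ≈⟨ ⊞-congˡ (constS (a j) · comp C u) (⊟-cong (·-congʳ (comp (∂ C) u) (≋-trans comp-1-t-u e≋E₀))) ⟩
    (constS (a j) · comp C u) ⊞ (⊟ (E 0 · comp (∂ C) u)) ∎
    where open ≋-Reasoning

  ∂-E·comp : ∀ j C → ∂ (E j · comp C u) ≋ (E (suc j) · comp (A-step j C) u)
  ∂-E·comp j C = begin
    ∂ (E j · comp C u)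
      ≈⟨ ∂-· (E j) (comp C u) ⟩
    (∂ (E j) · comp C u) ⊞ (E j · ∂ (comp C u))
      ≈⟨ ⊞-cong (·-congʳ (comp C u) (∂E j)) (·-congˡ (E j) (≋-trans (∂-comp C u-zero) (·-congˡ _ ∂u))) ⟩
    ((constS (a j) · E (suc j)) · comp C u) ⊞ (E j · (comp (∂ C) u · (⊟ E 1)))
      ≈⟨ solve 6 (λ c E′ x E E₁ y → (c :* E′) :* x :+ E :* (y :* (:- E₁))
                                    := E′ :* (c :* x) :- (E :* E₁) :* y) ≋-refl (constS (a j)) (E (suc j)) (comp C u) (E j) (E 1) (comp (∂ C) u) ⟩
    (E (suc j) · (constS (a j) · comp C u)) ⊞ (⊟ ((E j · E 1) · comp (∂ C) u))
      ≈⟨ ⊞-congˡ (E (suc j) · (constS (a j) · comp C u)) (⊟-cong (·-congʳ (comp (∂ C) u) (E·E₁ j))) ⟩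
    (E (suc j) · (constS (a j) · comp C u)) ⊞ (⊟ ((E (suc j) · E 0) · comp (∂ C) u))
      ≈⟨ solve 5 (λ E′ c x E₀ y → E′ :* (c :* x) :- (E′ :* E₀) :* y := E′ :* (c :* x :- E₀ :* y))
           ≋-refl (E (suc j)) (constS (a j)) (comp C u) (E 0) (comp (∂ C) u) ⟩
    E (suc j) · ((constS (a j) · comp C u) ⊞ (⊟ (E 0 · comp (∂ C) u)))
      ≈⟨ ·-congˡ (E (suc j)) (comp-A-step j C) ⟨
    E (suc j) · comp (A-step j C) u ∎
    where
    open ≋-Reasoning
    open IntegerSolver PSring

  Gbar-from-row : ∀ b j n → bmat lam b (j ℕ.+ n) 0 * inv (n !) ≈ (E j · comp (bmat lam b j) u) n
  Gbar-from-row b j zero rewrite ℕₚ.+-identityʳ j =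
    solve 2 (λ x i → x :* i := (con (+ 1) :* i) :* (x :* con (+ 1))) refl (bmat lam b j 0) (inv 1)
    where open IntegerSolver R
  Gbar-from-row b j (suc n) = fromℕ-cancel (suc n) (ℕ.s≤s ℕ.z≤n) (begin
    fromℕ (suc n) * (bmat lam b (j ℕ.+ suc n) 0 * inv (suc n !))
      ≈⟨ x∙yz≈y∙xz _ _ _ ⟩
    bmat lam b (j ℕ.+ suc n) 0 * (fromℕ (suc n) * inv (suc n !))
      ≈⟨ *-congˡ (fromℕ-suc-*-inv-! n) ⟩
    bmat lam b (j ℕ.+ suc n) 0 * inv (n !)
      ≡⟨ ≡.cong (λ k → bmat lam b k 0 * inv (n !)) (ℕₚ.+-suc j n) ⟩
    bmat lam b (suc j ℕ.+ n) 0 * inv (n !)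
      ≈⟨ Gbar-from-row b (suc j) n ⟩
    (E (suc j) · comp (A-step j (bmat lam b j)) u) n
      ≈⟨ ∂-E·comp j (bmat lam b j) n ⟨
    fromℕ (suc n) * (E j · comp (bmat lam b j) u) (suc n) ∎)
    where open ≈-Reasoning

  Gbar≋e·G∘u : ∀ b → Gbarλ lam inv b ≋ (e · comp (Gλ lam b) u)
  Gbar≋e·G∘u b n = trans (Gbar-from-row b 0 n) (·-congʳ (comp (Gλ lam b) u) (≋-sym e≋E₀) n)

module DegenerateLogarithm {c ℓ} (R : CommutativeRing c ℓ)
  (inv : ℕ → CommutativeRing.Carrier R) (fromℕ-suc-*-inv : IsReciprocal R inv)
  (lam : CommutativeRing.Carrier R) where
  open CommutativeRing R
  open Series R
  open PowerSeriesRing R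
  open Derivative R
  open Composition R
  open Reciprocals R inv fromℕ-suc-*-inv
  open LinearODE R inv fromℕ-suc-*-inv
  open FallingFactorial R
  open DegenerateExponential R inv fromℕ-suc-*-inv lam
  open AAlgorithm R inv fromℕ-suc-*-inv lam

  L : PS
  L = logλ1- lam inv

  L-zero : L 0 ≈ 0#
  L-zero = zeroʳ _

  -- F m / m! is the coefficient of t^m in (1 - t)^(λ - 1) = - ∂ L.
  F : ℕ → Carrier
  F m = fall (fromℕ m - lam) 1# m

  F-suc : ∀ m → F (suc m) ≈ (fromℕ (suc m) - lam) * F m
  F-suc m = trans (fall-suc _ 1# m) (*-congˡ (fall-cong 1# m (lower (fromℕ m) lam)))
    where
    open IntegerSolver R
    lower : ∀ m l → ((1# + m) - l) - 1# ≈ m - l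
    lower = solve 2 (λ m l → ((con (+ 1) :+ m) :- l) :- con (+ 1) := m :- l) refl

  sgn-sq : ∀ m → sgn m * sgn m ≈ 1#
  sgn-sq zero    = *-identityʳ _
  sgn-sq (suc m) = trans (solve 1 (λ s → (:- s) :* (:- s) := s :* s) refl (sgn m)) (sgn-sq m)
    where open IntegerSolver R

  L-suc : ∀ m → L (suc m) ≈ - (F m * inv (suc m !))
  L-suc m = begin
    (- s) * ((s * inv (suc m)) * (F m * inv (m !)))
      ≈⟨ solve 4 (λ s i x y → (:- s) :* ((s :* i) :* (x :* y)) := :- ((s :* s) :* (x :* (i :* y)))) refl
           s (inv (suc m)) (F m) (inv (m !)) ⟩
    - ((s * s) * (F m * (inv (suc m) * inv (m !))))
      ≈⟨ -‿cong (*-cong (sgn-sq m) (*-congˡ (inv-suc-! m))) ⟩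
    - (1# * (F m * inv (suc m !)))
      ≈⟨ -‿cong (*-identityˡ _) ⟩
    - (F m * inv (suc m !)) ∎
    where
    open ≈-Reasoning
    open IntegerSolver R
    s = sgn m

  ∂L : ∀ m → ∂ L m ≈ - (F m * inv (m !))
  ∂L m = begin
    fromℕ (suc m) * L (suc m)
      ≈⟨ *-congˡ (L-suc m) ⟩
    fromℕ (suc m) * - (F m * inv (suc m !))
      ≈⟨ solve 3 (λ k x y → k :* (:- (x :* y)) := :- (x :* (k :* y))) refl (fromℕ (suc m)) (F m) (inv (suc m !)) ⟩
    - (F m * (fromℕ (suc m) * inv (suc m !)))
      ≈⟨ -‿cong (*-congˡ (fromℕ-suc-*-inv-! m)) ⟩
    - (F m * inv (m !)) ∎
    where
    open ≈-Reasoning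
    open IntegerSolver R

  1-t·∂L : ((oneS -S tS) · ∂ L) ≋ (⊟ (oneS ⊞ (constS lam · L)))
  1-t·∂L zero = begin
    ((oneS -S tS) · ∂ L) 0
      ≈⟨ 1-t·-coeff (∂ L) 0 ⟩
    ∂ L 0 - (tS · ∂ L) 0
      ≈⟨ +-cong (trans (∂L 0) (-‿cong (trans (*-identityˡ _) inv-1))) (-‿cong (tS·-zero (∂ L))) ⟩
    - 1# - 0#
      ≈⟨ solve 1 (λ l → :- con (+ 1) :- con (+ 0) := :- (con (+ 1) :+ l :* con (+ 0))) refl lam ⟩
    - (1# + lam * 0#)
      ≈⟨ -‿cong (+-congˡ (*-congˡ L-zero)) ⟨
    - (1# + lam * L 0)
      ≈⟨ -‿cong (+-congˡ (constS-·-coeff lam L 0)) ⟨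
    - (oneS 0 + (constS lam · L) 0) ∎
    where
    open ≈-Reasoning
    open IntegerSolver R
  1-t·∂L (suc m) = begin
    ((oneS -S tS) · ∂ L) (suc m)
      ≈⟨ 1-t·-coeff (∂ L) (suc m) ⟩
    ∂ L (suc m) - (tS · ∂ L) (suc m)
      ≈⟨ +-cong (∂L (suc m)) (-‿cong (trans (tS·-suc (∂ L) m) (∂L m))) ⟩
    - (F (suc m) * inv (suc m !)) - - (F m * inv (m !))
      ≈⟨ +-cong (-‿cong (*-congʳ (F-suc m))) (-‿cong (-‿cong (*-congˡ (sym (fromℕ-suc-*-inv-! m))))) ⟩
    - (((s - lam) * F m) * J) - - (F m * (s * J))
      ≈⟨ solve 4 (λ s l x J → :- (((s :- l) :* x) :* J) :- :- (x :* (s :* J))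
                              := :- (con (+ 0) :+ l :* (:- (x :* J)))) refl s lam (F m) J ⟩
    - (0# + lam * - (F m * J))
      ≈⟨ -‿cong (+-congˡ (trans (*-congˡ (sym (L-suc m))) (sym (constS-·-coeff lam L (suc m))))) ⟩
    - (oneS (suc m) + (constS lam · L) (suc m)) ∎
    where
    open ≈-Reasoning
    open IntegerSolver R
    s = fromℕ (suc m)
    J = inv (suc m !)

  e∘L-ode : ((oneS -S tS) · ∂ (comp e L)) ≋ (⊟ comp e L)
  e∘L-ode = begin
    (oneS -S tS) · ∂ (comp e L)
      ≈⟨ ·-congˡ (oneS -S tS) (∂-comp e L-zero) ⟩
    (oneS -S tS) · (comp (∂ e) L · ∂ L)
      ≈⟨ solve 3 (λ p x y → p :* (x :* y) := x :* (p :* y)) ≋-refl (oneS -S tS) (comp (∂ e) L) (∂ L) ⟩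
    comp (∂ e) L · ((oneS -S tS) · ∂ L)
      ≈⟨ ·-congˡ (comp (∂ e) L) (≋-trans 1-t·∂L (⊟-cong (≋-sym (comp-1+[]t lam L-zero)))) ⟩
    comp (∂ e) L · (⊟ comp 1+[ lam ]t L)
      ≈⟨ solve 2 (λ x y → x :* (:- y) := :- (y :* x)) ≋-refl (comp (∂ e) L) (comp 1+[ lam ]t L) ⟩
    ⊟ (comp 1+[ lam ]t L · comp (∂ e) L)
      ≈⟨ ⊟-cong (≋-trans (≋-sym (comp-· 1+[ lam ]t (∂ e) L-zero)) (comp-congˡ L 1+λt·∂e)) ⟩
    ⊟ comp e L ∎
    where
    open ≋-Reasoning
    open IntegerSolver PSring

  1-t-ode : ((oneS -S tS) · ∂ (oneS -S tS)) ≋ (⊟ (oneS -S tS))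
  1-t-ode = begin
    (oneS -S tS) · ∂ (oneS ⊞ (⊟ tS))
      ≈⟨ ·-congˡ (oneS -S tS) (≋-trans (∂-⊞ oneS (⊟ tS)) (⊞-cong (λ _ → zeroʳ _) ∂[-t])) ⟩
    (oneS -S tS) · (zeroS ⊞ (⊟ oneS))
      ≈⟨ solve 1 (λ t → (con (+ 1) :- t) :* (con (+ 0) :- con (+ 1)) := :- (con (+ 1) :- t)) ≋-refl tS ⟩
    ⊟ (oneS -S tS) ∎
    where
    open ≋-Reasoning
    open IntegerSolver PSring
    ∂[-t] : ∂ (⊟ tS) ≋ (⊟ oneS)
    ∂[-t] = ≋-trans (∂-⊟ tS) (⊟-cong ∂-tS)

  as-affine-ode : ∀ {g} → ((oneS -S tS) · ∂ g) ≋ (⊟ g) → (1+[ - 1# ]t · ∂ g) ≋ (constS (- 1#) · g)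
  as-affine-ode {g} ode = begin
    (oneS ⊞ (constS (- 1#) · tS)) · ∂ g
      ≈⟨ ·-congʳ (∂ g) (⊞-congˡ oneS (·-congʳ tS constS-minus-one)) ⟩
    (oneS ⊞ ((⊟ oneS) · tS)) · ∂ g
      ≈⟨ solve 2 (λ t d → (con (+ 1) :+ (:- con (+ 1)) :* t) :* d := (con (+ 1) :- t) :* d) ≋-refl tS (∂ g) ⟩
    (oneS -S tS) · ∂ g
      ≈⟨ ode ⟩
    ⊟ g
      ≈⟨ solve 1 (λ g → :- g := (:- con (+ 1)) :* g) ≋-refl g ⟩
    (⊟ oneS) · g
      ≈⟨ ·-congʳ g constS-minus-one ⟨
    constS (- 1#) · g ∎
    where
    open ≋-Reasoning
    open IntegerSolver PSring
    open import Algebra.Properties.Ring ring using (-0#≈0#)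
    constS-minus-one : constS (- 1#) ≋ (⊟ oneS)
    constS-minus-one zero    = refl
    constS-minus-one (suc n) = sym -0#≈0#

  e∘L≋1-t : comp e L ≋ (oneS -S tS)
  e∘L≋1-t = ode-unique (- 1#) (- 1#) (as-affine-ode e∘L-ode) (as-affine-ode 1-t-ode) e∘L-zero
    where
    open import Algebra.Properties.Ring ring using (-0#≈0#)
    e∘L-zero : comp e L 0 ≈ 1# - 0#
    e∘L-zero = trans (comp-zero e L) (trans e-zero (sym (trans (+-congˡ -0#≈0#) (+-identityʳ 1#))))

  u∘L≋t : comp u L ≋ tS
  u∘L≋t = begin
    comp (oneS ⊞ (⊟ e)) L        ≈⟨ comp-⊞ oneS (⊟ e) L ⟩
    comp oneS L ⊞ comp (⊟ e) L   ≈⟨ ⊞-cong (comp-oneS L) (≋-trans (comp-⊟ e L) (⊟-cong e∘L≋1-t)) ⟩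
    oneS ⊞ (⊟ (oneS ⊞ (⊟ tS)))   ≈⟨ solve 1 (λ t → con (+ 1) :- (con (+ 1) :- t) := t) ≋-refl tS ⟩
    tS                           ∎
    where
    open ≋-Reasoning
    open IntegerSolver PSring

  Gbar∘L≋1-t·G : ∀ b → comp (Gbarλ lam inv b) L ≋ ((oneS -S tS) · Gλ lam b)
  Gbar∘L≋1-t·G b = begin
    comp (Gbarλ lam inv b) L           ≈⟨ comp-congˡ L (Gbar≋e·G∘u b) ⟩
    comp (e · comp G u) L              ≈⟨ comp-· e (comp G u) L-zero ⟩
    comp e L · comp (comp G u) L       ≈⟨ ·-cong e∘L≋1-t (comp-assoc G u-zero L-zero) ⟩
    (oneS -S tS) · comp G (comp u L)   ≈⟨ ·-congˡ (oneS -S tS) (≋-trans (comp-congʳ G u∘L≋t) (comp-tSʳ G)) ⟩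
    (oneS -S tS) · G                   ∎
    where
    open ≋-Reasoning
    G = Gλ lam b

theorem3p2 : ∀ {c ℓ} (R : CommutativeRing c ℓ) →
    let open CommutativeRing R
        open Series R
    in (inv : ℕ → Carrier) → (∀ n → fromℕ (suc n) * inv (suc n) ≈ 1#) →
       (lam : Carrier) → ¬ (lam ≈ 0#) → (b : ℕ → Carrier) →
       (Gbarλ lam inv b ≋ (eλ lam inv · comp (Gλ lam b) (oneS -S eλ lam inv)))
       × (((oneS -S tS) · Gλ lam b) ≋ comp (Gbarλ lam inv b) (logλ1- lam inv))
theorem3p2 R inv fromℕ-suc-*-inv lam _ b =
  Gbar≋e·G∘u b , PowerSeriesRing.≋-sym R (Gbar∘L≋1-t·G b)
  where
  open AAlgorithm R inv fromℕ-suc-*-inv lam using (Gbar≋e·G∘u)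
  open DegenerateLogarithm R inv fromℕ-suc-*-inv lam using (Gbar∘L≋1-t·G)
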